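{- Let $G$ be a graph with $mad(G)<3$ and $ch_3^d(G)\ge 9$ having the smallest number of vertices and edges among all such graphs. Then no vertex of degree at most $3$ in $G$ has a neighbor of degree $2$.
   Context: A 3-dynamic coloring of a graph $G$ is a proper vertex coloring such that every vertex $v$ sees at least $\min\{3,\deg_G(v)\}$ distinct colors in $N_G(v)$. $ch_3^d(G)$ is the least $k$ such that for every list assignment $L$ with $|L(v)|\ge k$ for all $v$, $G$ has a 3-dynamic coloring $\phi$ with $\phi(v)\in L(v)$ for all $v$. $mad(G)$ is the maximum of $2|E(H)|/|V(H)|$ over nonempty subgraphs $H$ of $G$. -}

module Defs where

open import Data.Nat using (ℕ; _+_; _*_; _≤_; _<_; _⊔_; _⊓_)
open import Data.Bool using (Bool; true; false; if_then_else_)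
open import Data.Fin using (Fin)
open import Data.List using (List; length; map; allFin)
open import Data.Nat.ListAction using (sum)
open import Data.List.Membership.Propositional using (_∈_)
open import Data.List.Relation.Unary.All using (All)
open import Data.List.Relation.Unary.Unique.Propositional using (Unique)
open import Data.Product using (Σ; _×_; ∃; proj₁)
open import Data.Sum using (_⊎_)
open import Relation.Binary.PropositionalEquality using (_≡_)
open import Relation.Nullary using (¬_)

count : {n : ℕ} → (Fin n → Bool) → ℕ
count {n} f = sum (map (λ i → if f i then 1 else 0) (allFin n))

record Graph : Set where
  field
    n     : ℕ
    adj   : Fin n → Fin n → Bool
    sym   : ∀ u v → adj u v ≡ adj v u
    loopless : ∀ v → adj v v ≡ false

open Graph public

Adj : (G : Graph) → Fin (n G) → Fin (n G) → Set
Adj G u v = adj G u v ≡ true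

∣V∣ : Graph → ℕ
∣V∣ G = n G

deg : (G : Graph) → Fin (n G) → ℕ
deg G v = count (adj G v)

twiceE : (G : Graph) → ℕ
twiceE G = sum (map (λ u → count (adj G u)) (allFin (n G)))

record Subgraph (G : Graph) : Set where
  field
    S    : Fin (n G) → Bool
    F    : Fin (n G) → Fin (n G) → Bool
    F-sym : ∀ u v → F u v ≡ F v u
    F-sub : ∀ u v → F u v ≡ true → (adj G u v ≡ true) × (S u ≡ true) × (S v ≡ true)

open Subgraph public

subV : {G : Graph} → Subgraph G → ℕ
subV H = count (S H)

subTwiceE : {G : Graph} → Subgraph G → ℕ
subTwiceE {G} H = sum (map (λ u → count (F H u)) (allFin (n G)))

-- mad(G) < 3 : every nonempty subgraph H has 2|E(H)|/|V(H)| < 3,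
-- i.e. 2|E(H)| < 3|V(H)|.
mad<3 : Graph → Set
mad<3 G = (H : Subgraph G) → 1 ≤ subV H → subTwiceE H < 3 * subV H

Proper : (G : Graph) → (Fin (n G) → ℕ) → Set
Proper G φ = ∀ u v → Adj G u v → ¬ (φ u ≡ φ v)

SeesAtLeast : (G : Graph) → (Fin (n G) → ℕ) → Fin (n G) → ℕ → Set
SeesAtLeast G φ v m =
  Σ (List ℕ) λ cs → Unique cs × m ≤ length cs
    × All (λ c → ∃ λ u → Adj G v u × φ u ≡ c) cs

ThreeDynamic : (G : Graph) → (Fin (n G) → ℕ) → Set
ThreeDynamic G φ = Proper G φ × (∀ v → SeesAtLeast G φ v (3 ⊓ deg G v))

ListAssignment : Graph → ℕ → Set
ListAssignment G k =
  Σ (Fin (n G) → List ℕ) λ L → ∀ v → Unique (L v) × k ≤ length (L v)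

Choosable3d : Graph → ℕ → Set
Choosable3d G k = (LA : ListAssignment G k) →
  Σ (Fin (n G) → ℕ) λ φ → ThreeDynamic G φ × (∀ v → φ v ∈ proj₁ LA v)

-- ch_3^d(G) ≥ k : G is not 3-dynamically j-choosable for any j < k
-- (ch_3^d(G) being the least j for which G is j-choosable).
ch3d≥ : Graph → ℕ → Set
ch3d≥ G k = ∀ j → j < k → ¬ Choosable3d G j

Bad : Graph → Set
Bad G = mad<3 G × ch3d≥ G 9

-- G' is smaller than G: fewer vertices, or the same number of vertices
-- and fewer edges (lexicographic order on (|V|, |E|)).
Smaller : Graph → Graph → Set
Smaller G' G = (∣V∣ G' < ∣V∣ G) ⊎ ((∣V∣ G' ≡ ∣V∣ G) × (twiceE G' < twiceE G))

MinimalBad : Graph → Set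
MinimalBad G = Bad G × (∀ G' → Smaller G' G → ¬ Bad G')

module Submission where

-- Delete the edges at the 2-vertex u.  The resulting graph H is smaller than G and still has
-- mad < 3, so by minimality it is 8-choosable; it remains to extend an 8-list colouring ψ of H
-- to G.  First recolour v, avoiding ψ w (w the other neighbour of u), the colours of its at most
-- two neighbours in H, and two distinct colours seen by each of those neighbours: at most 7
-- colours are excluded.  Then colour u, avoiding the colours of v and w and two colours seen by
-- each: at most 6 are excluded.  Now u sees the two distinct colours of v and w, and every
-- neighbour of u sees the new colour plus the two kept colours, so G is 8-choosable,
-- contradicting ch₃ᵈ(G) ≥ 9.

open import Defs
open import Data.Bool using (Bool; true; false; if_then_else_; not; _∧_)
import Data.Bool as Bool
open import Data.Fin using (Fin) renaming (zero to fzero; suc to fsuc)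
open import Data.Fin.Properties using (_≟_)
open import Data.List using (List; []; _∷_; length; map; allFin; filter; take; concatMap; _++_)
open import Data.List.Membership.Propositional using (_∈_; _∉_)
open import Data.List.Membership.Propositional.Properties
  using (∈-allFin; ∈-filter⁺; ∈-filter⁻; ∈-++⁺ˡ; ∈-++⁺ʳ; ∈-concatMap⁺)
open import Data.List.Properties
  using (map-tabulate; length-take; length-++; filter-notAll; filter-all; filter-accept; filter-reject)
open import Data.List.Relation.Unary.All using ([]; _∷_)
import Data.List.Relation.Unary.All as All
open import Data.List.Relation.Unary.All.Properties
  using (¬Any⇒All¬; all-filter) renaming (filter⁺ to All-filter⁺; take⁺ to All-take⁺)
open import Data.List.Relation.Unary.AllPairs using ([]; _∷_)
open import Data.List.Relation.Unary.Any using (here; there)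
import Data.List.Relation.Unary.Any as Any
open import Data.List.Relation.Unary.Unique.Propositional using (Unique)
import Data.List.Relation.Unary.Unique.Propositional.Properties as Unique
open import Data.Nat using (ℕ; zero; suc; _+_; _*_; _∸_; _≤_; _<_; _⊓_; z≤n; s≤s)
  renaming (_≟_ to _≟ℕ_)
open import Data.Nat.ListAction using (sum)
open import Data.List.Membership.DecPropositional _≟ℕ_ using (_∈?_)
open import Data.Nat.Properties
  using (≤-refl; ≤-trans; ≤-<-trans; <-≤-trans; ≤-reflexive; ≤-pred; n≤1+n; module ≤-Reasoning;
         +-comm; +-assoc; +-identityʳ; +-mono-≤; +-monoʳ-≤; +-mono-<-≤; +-mono-≤-<; *-monoˡ-≤;
         m∸n≤m; m+n∸n≡m; ∸-monoˡ-≤; ∸-distribʳ-⊓;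
         m⊓n≤m; m⊓n≤n; ⊓-glb; ⊓-monoˡ-≤; ⊓-monoʳ-≤)
open import Data.Product using (_×_; _,_; proj₁; proj₂; ∃)
open import Data.Sum using (inj₂)
open import Data.Vec.Functional using (updateAt)
open import Data.Vec.Functional.Properties using (updateAt-updates; updateAt-minimal)
open import Function using (_∘_; const)
open import Relation.Binary.PropositionalEquality using (_≡_; _≢_)
import Relation.Binary.PropositionalEquality as ≡
open ≡ using (refl; cong; trans; subst; module ≡-Reasoning)
open import Relation.Nullary using (¬_; Dec; yes; no; ¬?; contradiction)
open import Relation.Unary using (Decidable)
open import Relation.Nullary.Decidable using (does; dec-no)

toℕ : Bool → ℕ
toℕ b = if b then 1 else 0

sum-map-mono : {A : Set} {f g : A → ℕ} → (∀ x → f x ≤ g x) →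
  (xs : List A) → sum (map f xs) ≤ sum (map g xs)
sum-map-mono f≤g []       = z≤n
sum-map-mono f≤g (x ∷ xs) = +-mono-≤ (f≤g x) (sum-map-mono f≤g xs)

sum-map-mono-< : {A : Set} {f g : A → ℕ} → (∀ x → f x ≤ g x) →
  ∀ {y xs} → y ∈ xs → f y < g y → sum (map f xs) < sum (map g xs)
sum-map-mono-< f≤g {xs = x ∷ xs} (here refl)  fy<gy = +-mono-<-≤ fy<gy (sum-map-mono f≤g xs)
sum-map-mono-< f≤g {xs = x ∷ xs} (there y∈xs) fy<gy =
  +-mono-≤-< (f≤g x) (sum-map-mono-< f≤g y∈xs fy<gy)

count-suc : ∀ {n} (f : Fin (suc n) → Bool) → count f ≡ toℕ (f fzero) + count (f ∘ fsuc)
count-suc f = cong (λ xs → toℕ (f fzero) + sum xs)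
  (trans (map-tabulate fsuc (toℕ ∘ f)) (≡.sym (map-tabulate (λ i → i) (toℕ ∘ f ∘ fsuc))))

count-false : ∀ n → count {n} (const false) ≡ 0
count-false zero    = refl
count-false (suc n) = trans (count-suc {n} (const false)) (count-false n)

count-mono : ∀ {n} {f g : Fin n → Bool} → (∀ i → f i ≡ true → g i ≡ true) → count f ≤ count g
count-mono {n} {f} {g} f⇒g = sum-map-mono toℕ-mono (allFin n)
  where
  toℕ-mono : ∀ i → toℕ (f i) ≤ toℕ (g i)
  toℕ-mono i with f i in fi
  ... | true  rewrite f⇒g i fi = ≤-refl
  ... | false = z≤n

count-remove : ∀ {n} (f : Fin n → Bool) (u : Fin n) →
  count f ≡ count (λ i → not (does (i ≟ u)) ∧ f i) + toℕ (f u)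
count-remove {suc n} f fzero = begin
  count f                                            ≡⟨ count-suc f ⟩
  toℕ (f fzero) + count (f ∘ fsuc)                   ≡⟨ +-comm (toℕ (f fzero)) _ ⟩
  count (f ∘ fsuc) + toℕ (f fzero)                   ≡⟨ cong (_+ toℕ (f fzero)) (≡.sym (count-suc f′)) ⟩
  count f′ + toℕ (f fzero)                           ∎
  where
  open ≡-Reasoning
  f′ = λ i → not (does (i ≟ fzero)) ∧ f i
count-remove {suc n} f (fsuc u) = begin
  count f                                                  ≡⟨ count-suc f ⟩
  toℕ (f fzero) + count (f ∘ fsuc)                         ≡⟨ cong (toℕ (f fzero) +_) (count-remove (f ∘ fsuc) u) ⟩
  toℕ (f fzero) + (count (f′ ∘ fsuc) + toℕ (f (fsuc u)))   ≡⟨ ≡.sym (+-assoc (toℕ (f fzero)) _ _) ⟩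
  toℕ (f fzero) + count (f′ ∘ fsuc) + toℕ (f (fsuc u))     ≡⟨ cong (_+ toℕ (f (fsuc u))) (≡.sym (count-suc f′)) ⟩
  count f′ + toℕ (f (fsuc u))                              ∎
  where
  open ≡-Reasoning
  f′ = λ i → not (does (i ≟ fsuc u)) ∧ f i

count≡length-filter : {A : Set} (f : A → Bool) (xs : List A) →
  sum (map (toℕ ∘ f) xs) ≡ length (filter (λ x → f x Bool.≟ true) xs)
count≡length-filter f []       = refl
count≡length-filter f (x ∷ xs) with f x
... | true  = cong suc (count≡length-filter f xs)
... | false = count≡length-filter f xs

adj-sym : (G : Graph) {a b : Fin (n G)} → Adj G a b → Adj G b a
adj-sym G {a} {b} ab = trans (Graph.sym G b a) ab

adj⇒≢ : (G : Graph) {a b : Fin (n G)} → Adj G a b → a ≢ b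
adj⇒≢ G {a} ab refl with () ← trans (≡.sym ab) (loopless G a)

neighbours : (G : Graph) → Fin (n G) → List (Fin (n G))
neighbours G u = filter (λ x → adj G u x Bool.≟ true) (allFin (n G))

∈-neighbours⁺ : (G : Graph) {u x : Fin (n G)} → Adj G u x → x ∈ neighbours G u
∈-neighbours⁺ G {u} {x} = ∈-filter⁺ (λ x → adj G u x Bool.≟ true) (∈-allFin x)

∈-neighbours⁻ : (G : Graph) {u x : Fin (n G)} → x ∈ neighbours G u → Adj G u x
∈-neighbours⁻ G {u} = proj₂ ∘ ∈-filter⁻ (λ x → adj G u x Bool.≟ true) {xs = allFin (n G)}

neighbours-unique : (G : Graph) (u : Fin (n G)) → Unique (neighbours G u)
neighbours-unique G u = Unique.filter⁺ (λ x → adj G u x Bool.≟ true) (Unique.allFin⁺ (n G))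

length-neighbours : (G : Graph) (u : Fin (n G)) → length (neighbours G u) ≡ deg G u
length-neighbours G u = ≡.sym (count≡length-filter (adj G u) (allFin (n G)))

unique-∃-≢ : ∀ {m} {xs : List (Fin m)} → Unique xs → 2 ≤ length xs → ∀ v → ∃ λ w → w ∈ xs × w ≢ v
unique-∃-≢ {xs = a ∷ b ∷ _} ((a≢b ∷ _) ∷ _) (s≤s (s≤s _)) v with a ≟ v
... | no a≢v   = a , here refl , a≢v
... | yes refl = b , there (here refl) , a≢b ∘ ≡.sym

other-neighbour : (G : Graph) {u : Fin (n G)} → 2 ≤ deg G u → ∀ v → ∃ λ w → Adj G u w × w ≢ v
other-neighbour G {u} deg≥2 v
  with w , w∈ , w≢v ← unique-∃-≢ (neighbours-unique G u)
                        (subst (2 ≤_) (≡.sym (length-neighbours G u)) deg≥2) v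
  = w , ∈-neighbours⁻ G w∈ , w≢v

-- The vertex u is kept (isolated), so G ∖ u has the vertices of G and fewer edges.
_∖_ : (G : Graph) → Fin (n G) → Graph
G ∖ u = record { n = n G ; adj = adj∖ ; sym = sym∖ ; loopless = loopless∖ }
  where
  adj∖ : Fin (n G) → Fin (n G) → Bool
  adj∖ a b = not (does (a ≟ u)) ∧ not (does (b ≟ u)) ∧ adj G a b

  sym∖ : ∀ a b → adj∖ a b ≡ adj∖ b a
  sym∖ a b with a ≟ u | b ≟ u
  ... | yes _ | yes _ = refl
  ... | yes _ | no _  = refl
  ... | no _  | yes _ = refl
  ... | no _  | no _  = Graph.sym G a b

  loopless∖ : ∀ a → adj∖ a a ≡ false
  loopless∖ a with a ≟ u
  ... | yes _ = refl
  ... | no _  = loopless G a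

module _ (G : Graph) (u : Fin (n G)) where

  adj-∖⁻ : ∀ {a b} → Adj (G ∖ u) a b → Adj G a b × a ≢ u × b ≢ u
  adj-∖⁻ {a} {b} ab with a ≟ u | b ≟ u
  ... | no a≢u | no b≢u = ab , a≢u , b≢u

  adj-∖⁺ : ∀ {a b} → Adj G a b → a ≢ u → b ≢ u → Adj (G ∖ u) a b
  adj-∖⁺ {a} {b} ab a≢u b≢u rewrite dec-no (a ≟ u) a≢u | dec-no (b ≟ u) b≢u = ab

  deg-∖ : ∀ {y} → y ≢ u → deg G y ≡ deg (G ∖ u) y + toℕ (adj G y u)
  deg-∖ {y} y≢u rewrite dec-no (y ≟ u) y≢u = count-remove (adj G y) u

  deg-∖-self : deg (G ∖ u) u ≡ 0
  deg-∖-self with u ≟ u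
  ... | yes _   = count-false (n G)
  ... | no u≢u = contradiction refl u≢u

  twiceE-∖ : 0 < deg G u → twiceE (G ∖ u) < twiceE G
  twiceE-∖ deg>0 = sum-map-mono-< {f = deg (G ∖ u)} {g = deg G} deg-∖-mono (∈-allFin u)
    (subst (_< deg G u) (≡.sym deg-∖-self) deg>0)
    where
    deg-∖-mono : ∀ y → deg (G ∖ u) y ≤ deg G y
    deg-∖-mono y = count-mono (λ x → proj₁ ∘ adj-∖⁻ {y} {x})

  mad<3-∖ : mad<3 G → mad<3 (G ∖ u)
  mad<3-∖ mad K = mad record
    { S = S K ; F = F K ; F-sym = F-sym K
    ; F-sub = λ a b ab → let ab∖ , a∈S , b∈S = F-sub K a b ab in proj₁ (adj-∖⁻ ab∖) , a∈S , b∈S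
    }

≢? : (a : ℕ) → Decidable (_≢ a)
≢? a x = ¬? (x ≟ℕ a)

remove : ℕ → List ℕ → List ℕ
remove a = filter (≢? a)

length-remove< : ∀ {a xs} → a ∈ xs → length (remove a xs) < length xs
length-remove< {a} {xs} a∈xs = filter-notAll (≢? a) xs (Any.map (λ a≡x x≢a → x≢a (≡.sym a≡x)) a∈xs)

length-remove-unique : ∀ a {xs} → Unique xs → length xs ≤ suc (length (remove a xs))
length-remove-unique a {[]}     []           = z≤n
length-remove-unique a {x ∷ xs} (x∉xs ∷ uxs) with x ≟ℕ a
... | yes refl rewrite filter-reject (≢? x) {x} {xs} (λ x≢x → x≢x refl)
                     | filter-all (≢? x) (All.map (λ x≢y y≡x → x≢y (≡.sym y≡x)) x∉xs) = ≤-refl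
... | no x≢a   rewrite filter-accept (≢? a) {x} {xs} x≢a = s≤s (length-remove-unique a uxs)

∃-∉ : {L A : List ℕ} → Unique L → length A < length L → ∃ λ c → c ∈ L × c ∉ A
∃-∉ {x ∷ L} {A} (x∉L ∷ uL) (s≤s |A|≤|L|) with x ∈? A
... | no x∉A = x , here refl , x∉A
... | yes x∈A with c , c∈L , c∉A-x ← ∃-∉ {L} {remove x A} uL (<-≤-trans (length-remove< x∈A) |A|≤|L|)
  = c , there c∈L , λ c∈A →
      c∉A-x (∈-filter⁺ (≢? x) c∈A (λ c≡x → All.lookup x∉L c∈L (≡.sym c≡x)))

length-concatMap≤ : {A B : Set} {f : A → List B} {k : ℕ} → (∀ x → length (f x) ≤ k) →
  ∀ xs → length (concatMap f xs) ≤ length xs * k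
length-concatMap≤ f≤k []       = z≤n
length-concatMap≤ {f = f} f≤k (x ∷ xs) rewrite length-++ (f x) {concatMap f xs} =
  +-mono-≤ (f≤k x) (length-concatMap≤ f≤k xs)

free-colour : (G : Graph) (u : Fin (n G)) {k : ℕ} (B : Fin (n G) → List ℕ) →
  (∀ y → length (B y) ≤ k) → (E L : List ℕ) → Unique L → length E + deg G u * k < length L →
  ∃ λ c → c ∈ L × c ∉ E × (∀ y → Adj G u y → c ∉ B y)
free-colour G u {k} B |B|≤k E L uL room = avoiding (∃-∉ uL (≤-<-trans |E++B| room))
  where
  avoiding : ∃ (λ c → c ∈ L × c ∉ E ++ concatMap B (neighbours G u)) →
    ∃ λ c → c ∈ L × c ∉ E × (∀ y → Adj G u y → c ∉ B y)
  avoiding (c , c∈L , c∉) = c , c∈L , c∉ ∘ ∈-++⁺ˡ , λ y uy c∈By →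
    c∉ (∈-++⁺ʳ E (∈-concatMap⁺ B (Any.map (λ { refl → c∈By }) (∈-neighbours⁺ G uy))))

  |E++B| : length (E ++ concatMap B (neighbours G u)) ≤ length E + deg G u * k
  |E++B| rewrite length-++ E {concatMap B (neighbours G u)} | ≡.sym (length-neighbours G u) =
    +-monoʳ-≤ (length E) (length-concatMap≤ |B|≤k (neighbours G u))

sees-mono : ∀ {G φ y m k} → m ≤ k → SeesAtLeast G φ y k → SeesAtLeast G φ y m
sees-mono m≤k (cs , uniq , k≤ , seen) = cs , uniq , ≤-trans m≤k k≤ , seen

sees-pair : ∀ {G φ u v w} → Adj G u v → Adj G u w → φ v ≢ φ w → SeesAtLeast G φ u 2
sees-pair {φ = φ} {v = v} {w} uv uw φv≢φw =
  φ v ∷ φ w ∷ [] , (φv≢φw ∷ []) ∷ [] ∷ [] , ≤-refl , (v , uv , refl) ∷ (w , uw , refl) ∷ []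

sees-extra : ∀ {G φ y m x} (S : SeesAtLeast G φ y m) → Adj G y x → φ x ∉ take 2 (proj₁ S) →
  SeesAtLeast G φ y (suc (2 ⊓ m))
sees-extra {φ = φ} {m = m} {x} (cs , uniq , m≤ , seen) yx fresh =
  φ x ∷ take 2 cs , ¬Any⇒All¬ (take 2 cs) fresh ∷ Unique.take⁺ 2 uniq , len ,
  (x , yx , refl) ∷ All-take⁺ 2 seen
  where
  len : suc (2 ⊓ m) ≤ suc (length (take 2 cs))
  len rewrite length-take 2 cs = s≤s (⊓-monoʳ-≤ 2 m≤)

module _ (G : Graph) (u : Fin (n G)) where

  sees-∖-update : ∀ {ψ y m f} → SeesAtLeast (G ∖ u) ψ y m → SeesAtLeast G (updateAt ψ u f) y m
  sees-∖-update {ψ} (cs , uniq , m≤ , seen) = cs , uniq , m≤ , All.map lift seen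
    where
    lift : ∀ {y c f} → ∃ (λ x → Adj (G ∖ u) y x × ψ x ≡ c) → ∃ λ x → Adj G y x × updateAt ψ u f x ≡ c
    lift (x , yx , ψx≡c) with yx′ , _ , x≢u ← adj-∖⁻ G u yx =
      x , yx′ , trans (updateAt-minimal x u ψ x≢u) ψx≡c

  sees-self-update : ∀ {ψ m f} → SeesAtLeast G ψ u m → SeesAtLeast G (updateAt ψ u f) u m
  sees-self-update {ψ} (cs , uniq , m≤ , seen) = cs , uniq , m≤ , All.map lift seen
    where
    lift : ∀ {c f} → ∃ (λ x → Adj G u x × ψ x ≡ c) → ∃ λ x → Adj G u x × updateAt ψ u f x ≡ c
    lift (x , ux , ψx≡c) = x , ux , trans (updateAt-minimal x u ψ (adj⇒≢ G ux ∘ ≡.sym)) ψx≡c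

  sees-∖ : ∀ {ψ y m} → y ≢ u → SeesAtLeast G ψ y m → SeesAtLeast (G ∖ u) ψ y (m ∸ toℕ (adj G y u))
  sees-∖ {ψ} {y} y≢u (cs , uniq , m≤ , seen) with adj G y u in yu
  ... | false = cs , uniq , m≤ , All.map lift seen
    where
    lift : ∀ {c} → ∃ (λ x → Adj G y x × ψ x ≡ c) → ∃ λ x → Adj (G ∖ u) y x × ψ x ≡ c
    lift (x , yx , ψx≡c) =
      x , adj-∖⁺ G u yx y≢u (λ { refl → contradiction (trans (≡.sym yx) yu) λ () }) , ψx≡c
  ... | true = remove (ψ u) cs , Unique.filter⁺ (≢? (ψ u)) uniq ,
    ∸-monoˡ-≤ 1 (≤-trans m≤ (length-remove-unique (ψ u) uniq)) ,
    All.map lift (All.zip (All-filter⁺ (≢? (ψ u)) seen , all-filter (≢? (ψ u)) cs))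
    where
    lift : ∀ {c} → ∃ (λ x → Adj G y x × ψ x ≡ c) × c ≢ ψ u → ∃ λ x → Adj (G ∖ u) y x × ψ x ≡ c
    lift ((x , yx , ψx≡c) , c≢ψu) =
      x , adj-∖⁺ G u yx y≢u (λ { refl → c≢ψu (≡.sym ψx≡c) }) , ψx≡c

-- A neighbour of u will also see the colour given to u, so it needs one colour fewer from the rest.
record Extendable (G : Graph) (u : Fin (n G)) (ψ : Fin (n G) → ℕ) : Set where
  field
    proper : Proper (G ∖ u) ψ
    sees-u : SeesAtLeast G ψ u (3 ⊓ deg G u)
    sees   : ∀ y → SeesAtLeast (G ∖ u) ψ y ((3 ∸ toℕ (adj G y u)) ⊓ deg (G ∖ u) y)

  blocked : Fin (n G) → List ℕ
  blocked y = ψ y ∷ take 2 (proj₁ (sees y))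

  length-blocked : ∀ y → length (blocked y) ≤ 3
  length-blocked y rewrite length-take 2 (proj₁ (sees y)) = s≤s (m⊓n≤m 2 _)

module _ {G : Graph} {u : Fin (n G)} {ψ : Fin (n G) → ℕ} (E : Extendable G u ψ) where
  open Extendable E

  extend : ∀ c → (∀ y → Adj G u y → c ∉ blocked y) → ThreeDynamic G (updateAt ψ u (const c))
  extend c free = proper′ , sees′
    where
    φ : Fin (n G) → ℕ
    φ = updateAt ψ u (const c)

    φu≡c : φ u ≡ c
    φu≡c = updateAt-updates u ψ

    φ≡ψ : ∀ {y} → y ≢ u → φ y ≡ ψ y
    φ≡ψ {y} = updateAt-minimal y u ψ

    proper′ : Proper G φ
    proper′ a b ab φa≡φb with a ≟ u | b ≟ u
    ... | yes refl | yes refl = adj⇒≢ G ab refl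
    ... | yes refl | no b≢u   = free b ab (here (trans (≡.sym φu≡c) (trans φa≡φb (φ≡ψ b≢u))))
    ... | no a≢u   | yes refl =
      free a (adj-sym G ab) (here (trans (≡.sym φu≡c) (trans (≡.sym φa≡φb) (φ≡ψ a≢u))))
    ... | no a≢u   | no b≢u   =
      proper a b (adj-∖⁺ G u ab a≢u b≢u) (trans (≡.sym (φ≡ψ a≢u)) (trans φa≡φb (φ≡ψ b≢u)))

    sees′ : ∀ y → SeesAtLeast G φ y (3 ⊓ deg G y)
    sees′ y with y ≟ u
    ... | yes refl = sees-self-update G u sees-u
    ... | no y≢u rewrite deg-∖ G u y≢u with adj G y u in yu
    ...   | false = sees-mono {G} {y = y} far (sees-∖-update G u (sees y))
      where
      far : 3 ⊓ (deg (G ∖ u) y + 0) ≤ (3 ∸ toℕ (adj G y u)) ⊓ deg (G ∖ u) y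
      far rewrite yu | +-identityʳ (deg (G ∖ u) y) = ≤-refl
    ...   | true = sees-mono {G} {y = y} near
                     (sees-extra {G} {y = y} (sees-∖-update G u (sees y)) yu λ φu∈ →
                       free y (adj-sym G yu) (there (subst (_∈ take 2 (proj₁ (sees y))) φu≡c φu∈)))
      where
      near : 3 ⊓ (deg (G ∖ u) y + 1) ≤ suc (2 ⊓ ((3 ∸ toℕ (adj G y u)) ⊓ deg (G ∖ u) y))
      near rewrite yu | +-comm (deg (G ∖ u) y) 1 = s≤s (⊓-glb (m⊓n≤m 2 _) ≤-refl)

open Extendable using (blocked; length-blocked)

⊓-+-∸ : ∀ m d t → m ⊓ (d + t) ∸ t ≡ (m ∸ t) ⊓ d
⊓-+-∸ m d t = trans (∸-distribʳ-⊓ t m (d + t)) (cong ((m ∸ t) ⊓_) (m+n∸n≡m d t))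

module _ {G : Graph} {u : Fin (n G)} {ψ : Fin (n G) → ℕ} where

  dynamic⇒extendable : ThreeDynamic G ψ → Extendable G u ψ
  dynamic⇒extendable (proper , sees) = record
    { proper = λ a b ab → proper a b (proj₁ (adj-∖⁻ G u ab))
    ; sees-u = sees u
    ; sees   = λ y → sees∖ y (y ≟ u)
    }
    where
    sees∖ : ∀ y → Dec (y ≡ u) → SeesAtLeast (G ∖ u) ψ y ((3 ∸ toℕ (adj G y u)) ⊓ deg (G ∖ u) y)
    sees∖ y (yes refl) = [] , [] , ≤-trans (m⊓n≤n _ _) (≤-reflexive (deg-∖-self G u)) , []
    sees∖ y (no y≢u)   = subst (SeesAtLeast (G ∖ u) ψ y)
      (trans (cong (λ d → 3 ⊓ d ∸ toℕ (adj G y u)) (deg-∖ G u y≢u))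
             (⊓-+-∸ 3 (deg (G ∖ u) y) (toℕ (adj G y u))))
      (sees-∖ G u y≢u (sees y))

  dynamic-∖⇒extendable : ThreeDynamic (G ∖ u) ψ → SeesAtLeast G ψ u (3 ⊓ deg G u) → Extendable G u ψ
  dynamic-∖⇒extendable (proper , sees) sees-u = record
    { proper = proper
    ; sees-u = sees-u
    ; sees   = λ y → sees-mono {G ∖ u} {y = y} (⊓-monoˡ-≤ _ (m∸n≤m 3 (toℕ (adj G y u)))) (sees y)
    }

Choosable3d-mono : ∀ {G j k} → j ≤ k → Choosable3d G j → Choosable3d G k
Choosable3d-mono j≤k choose (L , L-ok) = choose (L , λ v → proj₁ (L-ok v) , ≤-trans j≤k (proj₂ (L-ok v)))

updateAt-∈ : ∀ {m} {L : Fin m → List ℕ} {ψ : Fin m → ℕ} {u c} →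
  (∀ y → ψ y ∈ L y) → c ∈ L u → ∀ y → updateAt ψ u (const c) y ∈ L y
updateAt-∈ {L = L} {ψ} {u} ψ∈L c∈Lu y with y ≟ u
... | yes refl = subst (_∈ L y) (≡.sym (updateAt-updates y ψ)) c∈Lu
... | no y≢u   = subst (_∈ L y) (≡.sym (updateAt-minimal y u ψ y≢u)) (ψ∈L y)

module _ (G : Graph) {u v : Fin (n G)} (deg-u : deg G u ≡ 2) (uv : Adj G u v) (deg-v : deg G v ≤ 3) where

  choosable-∖⇒choosable : Choosable3d (G ∖ u) 8 → Choosable3d G 8
  choosable-∖⇒choosable choose (L , L-ok) =
    let ψ , ψ-dyn , ψ∈L             = choose (L , L-ok)
        w , uw , w≢v                = other-neighbour G (≤-reflexive (≡.sym deg-u)) v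
        E₁                          = dynamic⇒extendable {G ∖ u} {v} ψ-dyn
        cv , cv∈L , cv∉ψw , cv-free = free-colour (G ∖ u) v (blocked E₁) (length-blocked E₁)
                                        (ψ w ∷ []) (L v) (proj₁ (L-ok v)) room-v
        E₂                          = dynamic-∖⇒extendable {G} {u} (extend E₁ cv cv-free)
                                        (u-sees-v-w ψ w cv uw w≢v cv∉ψw)
        cu , cu∈L , _ , cu-free     = free-colour G u (blocked E₂) (length-blocked E₂)
                                        [] (L u) (proj₁ (L-ok u)) room-u
    in updateAt (updateAt ψ v (const cv)) u (const cu) , extend E₂ cu cu-free ,
       updateAt-∈ (updateAt-∈ ψ∈L cv∈L) cu∈L
    where
    deg-∖-v : deg (G ∖ u) v ≤ 2
    deg-∖-v = ≤-pred (begin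
      suc (deg (G ∖ u) v)               ≡⟨ +-comm 1 (deg (G ∖ u) v) ⟩
      deg (G ∖ u) v + toℕ true          ≡⟨ cong (λ b → deg (G ∖ u) v + toℕ b) (≡.sym (adj-sym G uv)) ⟩
      deg (G ∖ u) v + toℕ (adj G v u)   ≡⟨ ≡.sym (deg-∖ G u (adj⇒≢ G (adj-sym G uv))) ⟩
      deg G v                           ≤⟨ deg-v ⟩
      3                                 ∎)
      where open ≤-Reasoning

    room-v : 1 + deg (G ∖ u) v * 3 < length (L v)
    room-v = ≤-trans (s≤s (s≤s (*-monoˡ-≤ 3 deg-∖-v))) (proj₂ (L-ok v))

    room-u : 0 + deg G u * 3 < length (L u)
    room-u rewrite deg-u = ≤-trans (n≤1+n 7) (proj₂ (L-ok u))

    u-sees-v-w : ∀ ψ w c → Adj G u w → w ≢ v → c ∉ ψ w ∷ [] →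
      SeesAtLeast G (updateAt ψ v (const c)) u (3 ⊓ deg G u)
    u-sees-v-w ψ w c uw w≢v c∉ψw rewrite deg-u = sees-pair {G} uv uw λ φv≡φw →
      c∉ψw (here (trans (≡.sym (updateAt-updates v ψ)) (trans φv≡φw (updateAt-minimal w v ψ w≢v))))

lemma5p1 : (G : Graph) → MinimalBad G →
    ∀ v u → deg G v ≤ 3 → adj G v u ≡ true → ¬ (deg G u ≡ 2)
lemma5p1 G ((mad , ch≥9) , minimal) v u deg-v vu deg-u =
  minimal (G ∖ u) (inj₂ (refl , twiceE-∖ G u deg-u>0)) (mad<3-∖ G u mad , ch-∖≥9)
  where
  deg-u>0 : 0 < deg G u
  deg-u>0 = subst (0 <_) (≡.sym deg-u) (s≤s z≤n)

  ch-∖≥9 : ch3d≥ (G ∖ u) 9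
  ch-∖≥9 j (s≤s j≤8) choosable = ch≥9 8 ≤-refl
    (choosable-∖⇒choosable G deg-u (adj-sym G vu) deg-v (Choosable3d-mono {G ∖ u} j≤8 choosable))
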